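{- Let $m\ge1$ and $m'=m+1$. For $S\in\mathrm{Sub}(\beta_{m,2})$ let $S'=\{(a+1,b+1):(a,b)\in S\}$, viewed as a $1$-subgraph of the inversion graph of $\beta_{m',2}$ on vertex set $[m'+2]$ (so vertex $1$ is isolated in $S'$). Then $S\mapsto S'$ is a bijection from the set of valid $1$-subgraphs in $\mathrm{Sub}(\beta_{m,2})$ onto the set of valid $1$-subgraphs $T\in\mathrm{Sub}(\beta_{m',2})$ in which vertex $1$ belongs to no edge of $T$.
   Context: For $N\ge1$, $[N]=\{1,\dots,N\}$. In the MVP parking process for a preference $p\in[N]^N$, cars $1,\dots,N$ enter in order a one-way street with spots $1,\dots,N$; car $i$ parks in spot $p_i$, and if $p_i$ was occupied by an earlier car $j$, car $j$ is bumped and parks in the first unoccupied spot $k>p_i$ (bumped cars do not bump others). The outcome $\mathcal{O}_{\mathrm{MVP}_N}(p)$ (when all cars park) is the permutation $\pi$ with $\pi_i$ the car in spot $i$ at the end. For $\pi\in S_N$, $\mathrm{Inv}(\pi)=\{(j,i):j<i,\ \pi_j>\pi_i\}$ and $\mathrm{Sub}(\pi)$ is the set of $S\subseteq\mathrm{Inv}(\pi)$ such that each $i$ has at most one $j$ with $(j,i)\in S$. For $S\in\mathrm{Sub}(\pi)$, $\Psi_{\mathrm{Sub}\to\mathrm{PF}}(S)$ is the preference $p$ with $p_{\pi_i}=i$ if no $(j,i)\in S$ and $p_{\pi_i}=j$ if $(j,i)\in S$; $S$ is valid if all cars park for $\Psi_{\mathrm{Sub}\to\mathrm{PF}}(S)$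 and $\mathcal{O}_{\mathrm{MVP}_N}(\Psi_{\mathrm{Sub}\to\mathrm{PF}}(S))=\pi$. $\beta_{m,2}=3\,4\cdots(m+2)\,1\,2\in S_{m+2}$, whose inversions are exactly the pairs $(a,m+b)$ with $a\in[m]$, $b\in\{1,2\}$. -}

module Defs where

open import Data.Nat as ℕ using (ℕ; zero; suc; _+_; _∸_; _≤_; _<_; s≤s; z≤n)
open import Data.Nat.Properties using (≤-trans; +-comm; m∸n≤m; ≤-<-trans; +-monoˡ-<)
open import Data.Fin as Fin using (Fin; toℕ; fromℕ<)
open import Data.Fin.Properties using (toℕ<n)
open import Data.Bool using (Bool; true; false; _∧_; not)
open import Data.Maybe using (Maybe; just; nothing; maybe; is-nothing; _>>=_)
open import Data.List using (List; []; _∷_; filterᵇ; head)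
open import Data.List.Base using (foldl)
open import Data.Vec using (Vec; lookup; _[_]≔_; replicate; tabulate)
open import Data.Product using (Σ; _×_; _,_)
open import Relation.Nullary.Decidable using (⌊_⌋; yes; no)
open import Relation.Binary.PropositionalEquality using (_≡_; subst; sym)

-- Conventions: [N] = {1,…,N} is represented by Fin N, with Fin index k
-- standing for the number k+1.  Cars and spots are both Fin N.

_==_ : ∀ {N} → Fin N → Fin N → Bool
i == j = ⌊ i Fin.≟ j ⌋

_<ᵇ_ : ∀ {N} → Fin N → Fin N → Bool
i <ᵇ j = ⌊ toℕ i ℕ.<? toℕ j ⌋

allFin : (N : ℕ) → List (Fin N)
allFin N = Data.List.tabulate {n = N} (λ i → i)
  where import Data.List

-- a street: for each spot, the car parked there (if any)
Street : ℕ → Set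
Street N = Vec (Maybe (Fin N)) N

firstFreeAfter : ∀ {N} → Street N → Fin N → Maybe (Fin N)
firstFreeAfter {N} s q =
  head (filterᵇ (λ k → (q <ᵇ k) ∧ is-nothing (lookup s k)) (allFin N))

-- car i enters with preferred spot q; nothing = some car fails to park
step : ∀ {N} → Fin N → Fin N → Street N → Maybe (Street N)
step i q s with lookup s q
... | nothing = just (s [ q ]≔ just i)
... | just j with firstFreeAfter s q
...   | nothing = nothing
...   | just k = just ((s [ q ]≔ just i) [ k ]≔ just j)

-- run the MVP process with preference p (p c = preferred spot of car c),
-- cars entering in order 1,…,N.  Result nothing iff some car fails to park.
runMVP : ∀ {N} → (Fin N → Fin N) → Maybe (Street N)
runMVP {N} p =
  foldl (λ ms i → ms >>= step i (p i)) (just (replicate N nothing)) (allFin N)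

-- "all cars park and O_MVP(p) = π"  (π i = car in spot i)
OutcomeIs : ∀ {N} → (Fin N → Fin N) → (Fin N → Fin N) → Set
OutcomeIs {N} p π = runMVP p ≡ just (tabulate (λ i → just (π i)))

-- a set of pairs (j , i) of [N]: S j i ≡ true iff (j , i) ∈ S
PairSet : ℕ → Set
PairSet N = Fin N → Fin N → Bool

_≐_ : ∀ {N} → PairSet N → PairSet N → Set
S ≐ T = ∀ j i → S j i ≡ T j i

IsInv : ∀ {N} → (Fin N → Fin N) → Fin N → Fin N → Set
IsInv π j i = (toℕ j < toℕ i) × (toℕ (π i) < toℕ (π j))

InSub : ∀ {N} → (Fin N → Fin N) → PairSet N → Set
InSub {N} π S =
  (∀ j i → S j i ≡ true → IsInv π j i) ×
  (∀ j j' i → S j i ≡ true → S j' i ≡ true → j ≡ j')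

-- the (first, hence unique for S ∈ Sub) j with (j , i) ∈ S, if any
partner : ∀ {N} → PairSet N → Fin N → Maybe (Fin N)
partner {N} S i = head (filterᵇ (λ j → S j i) (allFin N))

-- the position i with π i = c (π a permutation; default c otherwise)
position : ∀ {N} → (Fin N → Fin N) → Fin N → Fin N
position {N} π c = maybe (λ i → i) c (head (filterᵇ (λ i → π i == c) (allFin N)))

-- Ψ_{Sub→PF}(S):  p_{π_i} = i if no (j,i) ∈ S,  p_{π_i} = j if (j,i) ∈ S
Ψ : ∀ {N} → (Fin N → Fin N) → PairSet N → (Fin N → Fin N)
Ψ π S c = let i = position π c in maybe (λ j → j) i (partner S i)

Valid : ∀ {N} → (Fin N → Fin N) → PairSet N → Set
Valid π S = OutcomeIs (Ψ π S) π

ValidSub : ∀ {N} → (Fin N → Fin N) → PairSet N → Set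
ValidSub π S = InSub π S × Valid π S

-- β_{m,2} = 3 4 ⋯ (m+2) 1 2 ∈ S_{m+2}
-- (0-indexed: position a < m ↦ a+2, position m+b ↦ b)

β : (m : ℕ) → Fin (2 + m) → Fin (2 + m)
β m i with toℕ i ℕ.<? m
... | yes i<m =
  fromℕ< {toℕ i + 2} (subst (toℕ i + 2 <_) (+-comm m 2) (+-monoˡ-< 2 i<m))
... | no _ =
  fromℕ< {toℕ i ∸ m} (ℕ.s≤s (≤-trans′ (m∸n≤m (toℕ i) m) (toℕ<n i)))
  where
  ≤-trans′ : ∀ {a b c} → a ≤ b → b < c → a ℕ.≤ ℕ.pred c
  ≤-trans′ {c = suc c} a≤b (s≤s b≤c) = ≤-trans a≤b b≤c

shift : ∀ {N} → PairSet N → PairSet (suc N)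
shift S (Fin.suc a) (Fin.suc b) = S a b
shift S _ _ = false

FirstIsolated : ∀ {N} → PairSet (suc N) → Set
FirstIsolated T = ∀ x → (T Fin.zero x ≡ false) × (T x Fin.zero ≡ false)

-- β (suc m) is β m with a new car 3 placed in a new first spot and the old
-- cars 3, 4, … renamed 4, 5, ….  Shifting a 1-subgraph S of β m gives every
-- renamed car its old preference moved one spot to the right, while car 3
-- prefers spot 1 because no edge of the shift ends in vertex 1.  The MVP run
-- for the shifted subgraph is then the old run with an extra spot in front:
-- cars 1 and 2 never look at spot 1, car 3 takes it while it is still empty,
-- and bumped cars only move rightwards, so nobody later disturbs it.  Hence
-- S is valid exactly when its shift is, inversions correspond under the
-- shift, and the inverse map forgets the isolated vertex 1.
module Submission where

open import Defs
open import Data.Nat using (ℕ; suc; _+_; _≤_)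
open import Data.Product using (Σ; _×_)
import Data.Nat as ℕ
import Data.Nat.Properties as ℕ
open import Data.Fin as F using (Fin; zero; suc; toℕ; punchIn; punchOut; _≟_)
open import Data.Fin.Properties
  using (toℕ-injective; toℕ-fromℕ<; toℕ<n; suc-injective; punchIn-injective; punchInᵢ≢i;
         punchIn-mono-≤; punchIn-cancel-≤; punchIn-punchOut)
open import Data.Bool using (Bool; true; false; T; T?; _∧_)
open import Data.Maybe as Maybe using (Maybe; just; nothing; maybe; is-nothing; _>>=_)
import Data.Maybe.Properties as Maybe
open import Data.List as List using (List; []; _∷_; filterᵇ; head; foldl)
open import Data.List.Properties using (map-tabulate; head-map; filter-≐; foldl-cong)
open import Data.Vec as Vec using (_∷_; lookup; _[_]≔_; replicate; tabulate)
open import Data.Vec.Properties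
  using (∷-injective; lookup-map; map-[]≔; map-replicate; tabulate-∘; tabulate-cong)
open import Data.Product using (_,_; proj₁; proj₂; ∃-syntax)
open import Function using (_∘_; id; _⇔_; mk⇔; Injective)
open import Relation.Nullary using (Dec; ¬_; yes; no; contradiction)
open import Relation.Nullary.Decidable using (⌊_⌋; isYes≗does; does-⇔; dec-true; dec-false)
open import Relation.Binary.PropositionalEquality

isYes-⇔ : ∀ {A B : Set} → A ⇔ B → (a? : Dec A) (b? : Dec B) → ⌊ a? ⌋ ≡ ⌊ b? ⌋
isYes-⇔ A⇔B a? b? = trans (isYes≗does a?) (trans (does-⇔ A⇔B a? b?) (sym (isYes≗does b?)))

==-true : ∀ {N} {a b : Fin N} → a ≡ b → (a == b) ≡ true
==-true {a = a} {b} a≡b = trans (isYes≗does (a ≟ b)) (dec-true (a ≟ b) a≡b)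

==-false : ∀ {N} {a b : Fin N} → a ≢ b → (a == b) ≡ false
==-false {a = a} {b} a≢b = trans (isYes≗does (a ≟ b)) (dec-false (a ≟ b) a≢b)

==-injective : ∀ {N N′} {f : Fin N → Fin N′} → Injective _≡_ _≡_ f →
               ∀ a b → (f a == f b) ≡ (a == b)
==-injective {f = f} f-inj a b = isYes-⇔ (mk⇔ f-inj (cong f)) (f a ≟ f b) (a ≟ b)

<ᵇ-suc : ∀ {N} (a b : Fin N) → (suc a <ᵇ suc b) ≡ (a <ᵇ b)
<ᵇ-suc a b = isYes-⇔ (mk⇔ ℕ.s<s⁻¹ ℕ.s<s) _ _

is-nothing-map : ∀ {A B : Set} (f : A → B) (x : Maybe A) → is-nothing (Maybe.map f x) ≡ is-nothing x
is-nothing-map f nothing  = refl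
is-nothing-map f (just _) = refl

-- position, partner and firstFreeAfter all unfold to a search of this form.
first : ∀ {N} → (Fin N → Bool) → Maybe (Fin N)
first P = head (filterᵇ P (allFin _))

filterᵇ-map : ∀ {A B : Set} (P : B → Bool) (f : A → B) (xs : List A) →
              filterᵇ P (List.map f xs) ≡ List.map f (filterᵇ (P ∘ f) xs)
filterᵇ-map P f [] = refl
filterᵇ-map P f (x ∷ xs) with P (f x)
... | true  = cong (f x ∷_) (filterᵇ-map P f xs)
... | false = filterᵇ-map P f xs

first-zero : ∀ {N} (P : Fin (suc N) → Bool) → P zero ≡ true → first P ≡ just zero
first-zero P P0 rewrite P0 = refl

first-suc : ∀ {N} (P : Fin (suc N) → Bool) → P zero ≡ false →
            first P ≡ Maybe.map suc (first (P ∘ suc))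
first-suc {N} P P0 rewrite P0 =
  trans (cong (head ∘ filterᵇ P) (sym (map-tabulate id suc)))
        (trans (cong head (filterᵇ-map P suc (allFin N))) (head-map _))

first-cong : ∀ {N} {P Q : Fin N → Bool} → (∀ i → P i ≡ Q i) → first P ≡ first Q
first-cong {P = P} {Q} P≗Q =
  cong head (filter-≐ (T? ∘ P) (T? ∘ Q) (subst T (P≗Q _) , subst T (sym (P≗Q _))) (allFin _))

first-none : ∀ {N} (P : Fin N → Bool) → (∀ i → P i ≡ false) → first P ≡ nothing
first-none {ℕ.zero} P P≗false = refl
first-none {suc N} P P≗false =
  trans (first-suc P (P≗false zero)) (cong (Maybe.map suc) (first-none (P ∘ suc) (P≗false ∘ suc)))

first-satisfiable : ∀ {N} (P : Fin N → Bool) {i} → P i ≡ true → ∃[ j ] first P ≡ just j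
first-satisfiable P {zero}  Pi = zero , first-zero P Pi
first-satisfiable P {suc i} Pi = by-P0 (P zero) refl
  where
  by-P0 : ∀ b → P zero ≡ b → ∃[ j ] first P ≡ just j
  by-P0 true  P0 = zero , first-zero P P0
  by-P0 false P0 with first-satisfiable (P ∘ suc) Pi
  ... | j , first≡j = suc j , trans (first-suc P P0) (cong (Maybe.map suc) first≡j)

insertedCar : ∀ {n} → Fin (3 + n)
insertedCar = suc (suc zero)

relabel : ∀ {n} → Fin (2 + n) → Fin (3 + n)
relabel = punchIn insertedCar

relabel-injective : ∀ {n} → Injective _≡_ _≡_ (relabel {n})
relabel-injective {x = a} {b} = punchIn-injective insertedCar a b

toℕ-relabel-< : ∀ {n} (c : Fin (2 + n)) → toℕ c ℕ.< 2 → toℕ (relabel c) ≡ toℕ c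
toℕ-relabel-< zero          _ = refl
toℕ-relabel-< (suc zero)    _ = refl
toℕ-relabel-< (suc (suc c)) (ℕ.s≤s (ℕ.s≤s ()))

toℕ-relabel-≥ : ∀ {n} (c : Fin (2 + n)) → 2 ≤ toℕ c → toℕ (relabel c) ≡ suc (toℕ c)
toℕ-relabel-≥ (suc zero)    (ℕ.s≤s ())
toℕ-relabel-≥ (suc (suc c)) _ = refl

toℕ-β-< : ∀ m (i : Fin (2 + m)) → toℕ i ℕ.< m → toℕ (β m i) ≡ toℕ i + 2
toℕ-β-< m i i<m with toℕ i ℕ.<? m
... | yes _   = toℕ-fromℕ< _
... | no i≮m = contradiction i<m i≮m

toℕ-β-≮ : ∀ m (i : Fin (2 + m)) → ¬ toℕ i ℕ.< m → toℕ (β m i) ≡ toℕ i ℕ.∸ m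
toℕ-β-≮ m i i≮m with toℕ i ℕ.<? m
... | yes i<m = contradiction i<m i≮m
... | no _    = toℕ-fromℕ< _

β-zero-id : (i : Fin 2) → β 0 i ≡ i
β-zero-id i = toℕ-injective (toℕ-β-≮ 0 i λ ())

β-suc-zero : ∀ m → β (suc m) zero ≡ insertedCar
β-suc-zero m = toℕ-injective (toℕ-β-< (suc m) zero ℕ.z<s)

β-suc-suc : ∀ m (i : Fin (2 + m)) → β (suc m) (suc i) ≡ relabel (β m i)
β-suc-suc m i = by-cases (toℕ i ℕ.<? m)
  where
  open ≡-Reasoning
  by-cases : Dec (toℕ i ℕ.< m) → β (suc m) (suc i) ≡ relabel (β m i)
  by-cases (yes i<m) = toℕ-injective (begin
    toℕ (β (suc m) (suc i))  ≡⟨ toℕ-β-< (suc m) (suc i) (ℕ.s<s i<m) ⟩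
    suc (toℕ i + 2)          ≡⟨ cong suc (toℕ-β-< m i i<m) ⟨
    suc (toℕ (β m i))        ≡⟨ toℕ-relabel-≥ (β m i) 2≤βi ⟨
    toℕ (relabel (β m i))    ∎)
    where
    2≤βi : 2 ≤ toℕ (β m i)
    2≤βi = subst (2 ≤_) (sym (toℕ-β-< m i i<m)) (ℕ.m≤n+m 2 (toℕ i))
  by-cases (no i≮m) = toℕ-injective (begin
    toℕ (β (suc m) (suc i))  ≡⟨ toℕ-β-≮ (suc m) (suc i) (i≮m ∘ ℕ.s<s⁻¹) ⟩
    toℕ i ℕ.∸ m              ≡⟨ toℕ-β-≮ m i i≮m ⟨
    toℕ (β m i)              ≡⟨ toℕ-relabel-< (β m i) βi<2 ⟨
    toℕ (relabel (β m i))    ∎)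
    where
    βi<2 : toℕ (β m i) ℕ.< 2
    βi<2 = subst (ℕ._< 2) (sym (toℕ-β-≮ m i i≮m))
             (ℕ.m<n+o⇒m∸n<o (toℕ i) m (subst (toℕ i ℕ.<_) (ℕ.+-comm 2 m) (toℕ<n i)))

β-surjective : ∀ m (c : Fin (2 + m)) → ∃[ i ] β m i ≡ c
β-surjective ℕ.zero c = c , β-zero-id c
β-surjective (suc m) c with insertedCar ≟ c
... | yes refl = zero , β-suc-zero m
... | no 3≢c with β-surjective m (punchOut 3≢c)
...   | i , βi≡c′ = suc i , trans (β-suc-suc m i) (trans (cong relabel βi≡c′) (punchIn-punchOut 3≢c))

punchIn-mono-< : ∀ {n} i (j k : Fin n) → j F.< k → punchIn i j F.< punchIn i k
punchIn-mono-< i j k j<k = ℕ.≰⇒> (ℕ.<⇒≱ j<k ∘ punchIn-cancel-≤ i k j)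

punchIn-cancel-< : ∀ {n} i (j k : Fin n) → punchIn i j F.< punchIn i k → j F.< k
punchIn-cancel-< i j k j<k = ℕ.≰⇒> (ℕ.<⇒≱ j<k ∘ punchIn-mono-≤ i k j)

IsInv-β-suc⁺ : ∀ m {a b} → IsInv (β m) a b → IsInv (β (suc m)) (suc a) (suc b)
IsInv-β-suc⁺ m {a} {b} (a<b , βb<βa) rewrite β-suc-suc m a | β-suc-suc m b =
  ℕ.s<s a<b , punchIn-mono-< insertedCar (β m b) (β m a) βb<βa

IsInv-β-suc⁻ : ∀ m {a b} → IsInv (β (suc m)) (suc a) (suc b) → IsInv (β m) a b
IsInv-β-suc⁻ m {a} {b} (a<b , βb<βa) rewrite β-suc-suc m a | β-suc-suc m b =
  ℕ.s<s⁻¹ a<b , punchIn-cancel-< insertedCar (β m b) (β m a) βb<βa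

InSub-shift⁺ : ∀ {m} {S : PairSet (2 + m)} → InSub (β m) S → InSub (β (suc m)) (shift S)
InSub-shift⁺ {m} {S} (inverted , unique) = inverted′ , unique′
  where
  inverted′ : ∀ j i → shift S j i ≡ true → IsInv (β (suc m)) j i
  inverted′ (suc a) (suc b) Sab = IsInv-β-suc⁺ m (inverted a b Sab)
  inverted′ zero    _       ()
  inverted′ (suc a) zero    ()
  unique′ : ∀ j j′ i → shift S j i ≡ true → shift S j′ i ≡ true → j ≡ j′
  unique′ (suc a) (suc a′) (suc b) Sab Sa′b = cong suc (unique a a′ b Sab Sa′b)
  unique′ zero    _        _       ()
  unique′ (suc a) zero     (suc b) _   ()
  unique′ (suc a) _        zero    ()

InSub-shift⁻ : ∀ {m} {S : PairSet (2 + m)} → InSub (β (suc m)) (shift S) → InSub (β m) S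
InSub-shift⁻ {m} (inverted , unique) =
  (λ a b Sab → IsInv-β-suc⁻ m (inverted (suc a) (suc b) Sab)) ,
  (λ a a′ b Sab Sa′b → suc-injective (unique (suc a) (suc a′) (suc b) Sab Sa′b))

InSub-resp-≐ : ∀ {N} {π : Fin N → Fin N} {S T : PairSet N} → S ≐ T → InSub π S → InSub π T
InSub-resp-≐ S≐T (inverted , unique) =
  (λ j i Tji → inverted j i (trans (S≐T j i) Tji)) ,
  (λ j j′ i Tji Tj′i → unique j j′ i (trans (S≐T j i) Tji) (trans (S≐T j′ i) Tj′i))

position-β-suc-relabel : ∀ m (c : Fin (2 + m)) →
                         position (β (suc m)) (relabel c) ≡ suc (position (β m) c)
position-β-suc-relabel m c
  with i , βi≡c ← β-surjective m c
  with j , first≡j ← first-satisfiable (λ k → β m k == c) (==-true βi≡c) = begin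
  maybe id (relabel c) (first (λ k → β (suc m) k == relabel c))
    ≡⟨ cong (maybe id (relabel c)) (first-suc (λ k → β (suc m) k == relabel c) (==-false β0≢c′)) ⟩
  maybe id (relabel c) (Maybe.map suc (first (λ k → β (suc m) (suc k) == relabel c)))
    ≡⟨ cong (maybe id (relabel c) ∘ Maybe.map suc) (trans (first-cong unshifted) first≡j) ⟩
  suc j
    ≡⟨ cong (suc ∘ maybe id c) first≡j ⟨
  suc (position (β m) c) ∎
  where
  open ≡-Reasoning
  β0≢c′ : β (suc m) zero ≢ relabel c
  β0≢c′ β0≡c′ = punchInᵢ≢i insertedCar c (trans (sym β0≡c′) (β-suc-zero m))
  unshifted : ∀ k → (β (suc m) (suc k) == relabel c) ≡ (β m k == c)
  unshifted k = trans (cong (_== relabel c) (β-suc-suc m k)) (==-injective relabel-injective (β m k) c)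

position-β-suc-inserted : ∀ m → position (β (suc m)) insertedCar ≡ zero
position-β-suc-inserted m =
  cong (maybe id insertedCar) (first-zero (λ k → β (suc m) k == insertedCar) (==-true (β-suc-zero m)))

partner-shift-suc : ∀ {N} (S : PairSet N) i → partner (shift S) (suc i) ≡ Maybe.map suc (partner S i)
partner-shift-suc S i = first-suc (λ j → shift S j (suc i)) refl

partner-shift-zero : ∀ {N} (S : PairSet N) → partner (shift S) zero ≡ nothing
partner-shift-zero S = first-none (λ j → shift S j zero) λ { zero → refl ; (suc _) → refl }

Ψ-shift-relabel : ∀ m (S : PairSet (2 + m)) c →
                  Ψ (β (suc m)) (shift S) (relabel c) ≡ suc (Ψ (β m) S c)
Ψ-shift-relabel m S c
  rewrite position-β-suc-relabel m c | partner-shift-suc S (position (β m) c)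
  with partner S (position (β m) c)
... | nothing = refl
... | just _  = refl

Ψ-shift-inserted : ∀ m (S : PairSet (2 + m)) → Ψ (β (suc m)) (shift S) insertedCar ≡ zero
Ψ-shift-inserted m S rewrite position-β-suc-inserted m | partner-shift-zero S = refl

Ψ-cong : ∀ {N} (π : Fin N → Fin N) {S T : PairSet N} → S ≐ T → ∀ c → Ψ π S c ≡ Ψ π T c
Ψ-cong π S≐T c = cong (maybe id (position π c)) (first-cong λ j → S≐T j (position π c))

prependSpot : ∀ {n} → (Fin n → Fin (suc n)) → Maybe (Fin (suc n)) → Street n → Street (suc n)
prependSpot f h s = h ∷ Vec.map (Maybe.map f) s

Vec-map-injective : ∀ {A B : Set} {n} {f : A → B} → Injective _≡_ _≡_ f →
                    Injective _≡_ _≡_ (Vec.map {n = n} f)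
Vec-map-injective f-inj {Vec.[]}  {Vec.[]}  _   = refl
Vec-map-injective f-inj {x ∷ xs} {y ∷ ys} fxs≡fys with ∷-injective fxs≡fys
... | fx≡fy , fxs≡fys′ = cong₂ _∷_ (f-inj fx≡fy) (Vec-map-injective f-inj fxs≡fys′)

prependSpot-injective : ∀ {n} {f : Fin n → Fin (suc n)} h → Injective _≡_ _≡_ f →
                        Injective _≡_ _≡_ (prependSpot f h)
prependSpot-injective h f-inj = Vec-map-injective (Maybe.map-injective f-inj) ∘ proj₂ ∘ ∷-injective

firstFreeAfter-prependSpot : ∀ {n} f h (s : Street n) q →
  firstFreeAfter (prependSpot f h s) (suc q) ≡ Maybe.map suc (firstFreeAfter s q)
firstFreeAfter-prependSpot f h s q =
  trans (first-suc free refl) (cong (Maybe.map suc) (first-cong free-suc))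
  where
  free = λ k → (suc q <ᵇ k) ∧ is-nothing (lookup (prependSpot f h s) k)
  free-suc : ∀ k → free (suc k) ≡ ((q <ᵇ k) ∧ is-nothing (lookup s k))
  free-suc k rewrite lookup-map k (Maybe.map f) s =
    cong₂ _∧_ (<ᵇ-suc q k) (is-nothing-map f (lookup s k))

step-prependSpot : ∀ {n} f h (c q : Fin n) (s : Street n) →
  step (f c) (suc q) (prependSpot f h s) ≡ Maybe.map (prependSpot f h) (step c q s)
step-prependSpot f h c q s rewrite lookup-map q (Maybe.map f) s with lookup s q
... | nothing = cong (λ s′ → just (h ∷ s′)) (sym (map-[]≔ (Maybe.map f) s q))
... | just j rewrite firstFreeAfter-prependSpot f h s q with firstFreeAfter s q
...   | nothing = refl
...   | just k  = cong (λ s′ → just (h ∷ s′)) (sym (begin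
  Vec.map (Maybe.map f) ((s [ q ]≔ just c) [ k ]≔ just j)
    ≡⟨ map-[]≔ (Maybe.map f) (s [ q ]≔ just c) k ⟩
  Vec.map (Maybe.map f) (s [ q ]≔ just c) [ k ]≔ just (f j)
    ≡⟨ cong (_[ k ]≔ just (f j)) (map-[]≔ (Maybe.map f) s q) ⟩
  (Vec.map (Maybe.map f) s [ q ]≔ just (f c)) [ k ]≔ just (f j) ∎))
  where open ≡-Reasoning

enter : ∀ {N} → (Fin N → Fin N) → Maybe (Street N) → Fin N → Maybe (Street N)
enter p ms c = ms >>= step c (p c)

foldl-enter-prependSpot :
  ∀ {n} {f : Fin n → Fin (suc n)} {p : Fin n → Fin n} {p′ : Fin (suc n) → Fin (suc n)} →
  (∀ c → p′ (f c) ≡ suc (p c)) → ∀ h ms cs →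
  foldl (enter p′) (Maybe.map (prependSpot f h) ms) (List.map f cs)
    ≡ Maybe.map (prependSpot f h) (foldl (enter p) ms cs)
foldl-enter-prependSpot p′∘f≗suc∘p h ms [] = refl
foldl-enter-prependSpot {f = f} {p} {p′} p′∘f≗suc∘p h ms (c ∷ cs) =
  trans (cong (λ ms′ → foldl (enter p′) ms′ (List.map f cs)) (enter-one ms))
        (foldl-enter-prependSpot p′∘f≗suc∘p h (enter p ms c) cs)
  where
  enter-one : ∀ ms → enter p′ (Maybe.map (prependSpot f h) ms) (f c)
                       ≡ Maybe.map (prependSpot f h) (enter p ms c)
  enter-one nothing  = refl
  enter-one (just s) rewrite p′∘f≗suc∘p c = step-prependSpot f h c (p c) s

runMVP-cong : ∀ {N} {p q : Fin N → Fin N} → (∀ c → p c ≡ q c) → runMVP p ≡ runMVP q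
runMVP-cong p≗q = foldl-cong (λ ms c → cong (λ q → ms >>= step c q) (p≗q c)) _ (allFin _)

-- Cars 1 and 2 enter before car 3 and never touch spot 1, which is therefore
-- still empty when car 3 claims it.
runMVP-insert : ∀ {n} (p : Fin (2 + n) → Fin (2 + n)) (p′ : Fin (3 + n) → Fin (3 + n)) →
  (∀ c → p′ (relabel c) ≡ suc (p c)) → p′ insertedCar ≡ zero →
  runMVP p′ ≡ Maybe.map (prependSpot relabel (just insertedCar)) (runMVP p)
runMVP-insert {n} p p′ p′∘relabel≗suc∘p p′3≡1 = begin
  foldl (enter p′) (enter p′ (foldl (enter p′) (empty (3 + n)) first-two) insertedCar) later′
    ≡⟨ cong (λ ms → foldl (enter p′) (enter p′ ms insertedCar) later′) (begin
         foldl (enter p′) (empty (3 + n)) first-two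
           ≡⟨ cong (λ ms → foldl (enter p′) ms first-two) empty-prepend ⟨
         foldl (enter p′) (Maybe.map (E nothing) (empty (2 + n))) (List.map relabel first-two)
           ≡⟨ foldl-enter-prependSpot {p = p} {p′} p′∘relabel≗suc∘p nothing (empty (2 + n)) first-two ⟩
         Maybe.map (E nothing) early ∎) ⟩
  foldl (enter p′) (enter p′ (Maybe.map (E nothing) early) insertedCar) later′
    ≡⟨ cong₂ (foldl (enter p′)) (car3-claims-spot1 early) (sym (map-tabulate (F.suc ∘ F.suc) relabel)) ⟩
  foldl (enter p′) (Maybe.map (E (just insertedCar)) early) (List.map relabel later)
    ≡⟨ foldl-enter-prependSpot {p = p} {p′} p′∘relabel≗suc∘p (just insertedCar) early later ⟩
  Maybe.map (E (just insertedCar)) (foldl (enter p) early later) ∎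
  where
  open ≡-Reasoning
  E = prependSpot relabel
  empty : ∀ N → Maybe (Street N)
  empty N = just (replicate N nothing)
  first-two : ∀ {N} → List (Fin (2 + N))
  first-two = zero ∷ suc zero ∷ []
  later : List (Fin (2 + n))
  later = List.tabulate (F.suc ∘ F.suc)
  later′ : List (Fin (3 + n))
  later′ = List.tabulate (F.suc ∘ F.suc ∘ F.suc)
  early : Maybe (Street (2 + n))
  early = foldl (enter p) (empty (2 + n)) first-two
  empty-prepend : Maybe.map (E nothing) (empty (2 + n)) ≡ empty (3 + n)
  empty-prepend = cong (just ∘ (nothing ∷_)) (map-replicate (Maybe.map relabel) nothing (2 + n))
  car3-claims-spot1 : ∀ ms → enter p′ (Maybe.map (E nothing) ms) insertedCar
                               ≡ Maybe.map (E (just insertedCar)) ms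
  car3-claims-spot1 nothing  = refl
  car3-claims-spot1 (just s) rewrite p′3≡1 = refl

outcome-β-suc : ∀ m → prependSpot relabel (just insertedCar) (tabulate (just ∘ β m))
                        ≡ tabulate (just ∘ β (suc m))
outcome-β-suc m = cong₂ _∷_ (cong just (sym (β-suc-zero m)))
  (trans (sym (tabulate-∘ (Maybe.map relabel) (just ∘ β m)))
         (tabulate-cong (λ i → cong just (sym (β-suc-suc m i)))))

runMVP-Ψ-shift : ∀ m (S : PairSet (2 + m)) →
  runMVP (Ψ (β (suc m)) (shift S))
    ≡ Maybe.map (prependSpot relabel (just insertedCar)) (runMVP (Ψ (β m) S))
runMVP-Ψ-shift m S = runMVP-insert _ _ (Ψ-shift-relabel m S) (Ψ-shift-inserted m S)

Valid-shift⁺ : ∀ {m} {S : PairSet (2 + m)} → Valid (β m) S → Valid (β (suc m)) (shift S)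
Valid-shift⁺ {m} {S} valid = trans (runMVP-Ψ-shift m S)
  (trans (cong (Maybe.map (prependSpot relabel (just insertedCar))) valid) (cong just (outcome-β-suc m)))

Valid-shift⁻ : ∀ {m} {S : PairSet (2 + m)} → Valid (β (suc m)) (shift S) → Valid (β m) S
Valid-shift⁻ {m} {S} valid =
  Maybe.map-injective (prependSpot-injective (just insertedCar) relabel-injective)
    (trans (sym (runMVP-Ψ-shift m S)) (trans valid (cong just (sym (outcome-β-suc m)))))

Valid-resp-≐ : ∀ {N} {π : Fin N → Fin N} {S T : PairSet N} → S ≐ T → Valid π S → Valid π T
Valid-resp-≐ {π = π} S≐T valid = trans (sym (runMVP-cong (Ψ-cong π S≐T))) valid

ValidSub-shift⁺ : ∀ {m} {S : PairSet (2 + m)} → ValidSub (β m) S → ValidSub (β (suc m)) (shift S)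
ValidSub-shift⁺ (sub , valid) = InSub-shift⁺ sub , Valid-shift⁺ valid

ValidSub-shift⁻ : ∀ {m} {S : PairSet (2 + m)} → ValidSub (β (suc m)) (shift S) → ValidSub (β m) S
ValidSub-shift⁻ (sub , valid) = InSub-shift⁻ sub , Valid-shift⁻ valid

ValidSub-resp-≐ : ∀ {N} {π : Fin N → Fin N} {S T : PairSet N} → S ≐ T → ValidSub π S → ValidSub π T
ValidSub-resp-≐ S≐T (sub , valid) = InSub-resp-≐ S≐T sub , Valid-resp-≐ S≐T valid

unshift : ∀ {N} → PairSet (suc N) → PairSet N
unshift T a b = T (suc a) (suc b)

shift-FirstIsolated : ∀ {N} (S : PairSet N) → FirstIsolated (shift S)
shift-FirstIsolated S zero    = refl , refl
shift-FirstIsolated S (suc _) = refl , refl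

shift-unshift : ∀ {N} (T : PairSet (suc N)) → FirstIsolated T → shift (unshift T) ≐ T
shift-unshift T isolated zero    i       = sym (proj₁ (isolated i))
shift-unshift T isolated (suc a) zero    = sym (proj₂ (isolated (suc a)))
shift-unshift T isolated (suc a) (suc b) = refl

lemma4p3 : (m : ℕ) → 1 ≤ m →
    ((S : PairSet (2 + m)) → ValidSub (β m) S →
      ValidSub (β (suc m)) (shift S) × FirstIsolated (shift S))
    × ((S₁ S₂ : PairSet (2 + m)) → ValidSub (β m) S₁ → ValidSub (β m) S₂ →
      shift S₁ ≐ shift S₂ → S₁ ≐ S₂)
    × ((T : PairSet (2 + suc m)) → ValidSub (β (suc m)) T → FirstIsolated T →
      Σ (PairSet (2 + m)) (λ S → ValidSub (β m) S × (shift S ≐ T)))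
lemma4p3 m _ =
  (λ S valid → ValidSub-shift⁺ valid , shift-FirstIsolated S) ,
  (λ S₁ S₂ _ _ shift-S₁≐S₂ a b → shift-S₁≐S₂ (suc a) (suc b)) ,
  (λ T valid isolated → unshift T ,
     ValidSub-shift⁻
       (ValidSub-resp-≐ {T = shift (unshift T)} (λ j i → sym (shift-unshift T isolated j i)) valid) ,
     shift-unshift T isolated)
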